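{- Let $\Gamma$ be a hyperelliptic tropical curve whose underlying weighted graph is stable, and let $\tau$ be its hyperelliptic involution. Let $S$ be a C1-set of $\Gamma$. Then either $S$ consists of one edge and $\tau$ flips it, or $S$ consists of two edges and $\tau$ exchanges them.
   Context: A weighted graph $(G,w)$ is a finite connected graph (loops, multiple edges allowed; edges are pairs of half-edges) with $w:V(G)\to\mathbb Z_{\ge0}$; it is stable if $2w(v)-2+\mathrm{val}(v)>0$ for all $v$ (loops count twice). A tropical curve adds positive edge lengths. An involution of a tropical curve is an automorphism of order dividing 2 of the graph (acting on half-edges) preserving weights and lengths; an edge whose two half-edges are exchanged is flipped. The quotient $\Gamma/\tau$ has vertices the $\tau$-orbits of vertices and edges the $\tau$-orbits of non-flipped edges. A stable tropical curve of genus $\ge2$ is hyperelliptic if it has an involution fixing all positive-weight vertices with $\Gamma/\tau$ a tree; the hyperelliptic involution is the unique such involution fixing every separating edge pointwise. An edge is separating if deleting it disconnects the graph. On nonseparating edges, $e\sim f$ iff $e=f$ or deleting both disconnects the graph; the equivalence classes are the C1-sets. -}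

module Defs where

open import Data.Nat using (ℕ; _+_; _*_; _∸_; _≤_; _<_)
open import Data.Nat.DivMod using (_/_)
open import Data.Fin using (Fin) renaming (_≟_ to _≟ᶠ_)
open import Data.List using (List; length; filter; map; allFin)
open import Data.Nat.ListAction using (sum)
open import Data.Product using (Σ; _×_)
open import Data.Sum using (_⊎_)
open import Data.Empty using (⊥)
open import Relation.Nullary using (¬_)
open import Relation.Binary.PropositionalEquality using (_≡_)

-- Edges: the orbits {x , ι x} of the
-- fixed-point-free involution ι.  r x is the vertex at which half-edge x is rooted.
record WGraph : Set where
  field
    n h     : ℕ
    ι       : Fin h → Fin h
    ι-invol : ∀ x → ι (ι x) ≡ x
    ι-fpf   : ∀ x → ¬ (ι x ≡ x)
    r       : Fin h → Fin n
    w       : Fin n → ℕ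

record TropCurve (L : Set) : Set where
  field
    graph   : WGraph
  open WGraph graph public
  field
    len     : Fin h → L
    len-sym : ∀ x → len (ι x) ≡ len x

module _ (G : WGraph) where
  open WGraph G

  SameEdge : Fin h → Fin h → Set
  SameEdge x y = (x ≡ y) ⊎ (x ≡ ι y)

  -- valence: number of half-edges rooted at v (a loop counts twice)
  val : Fin n → ℕ
  val v = length (filter (λ x → r x ≟ᶠ v) (allFin h))

  Stable : Set
  Stable = ∀ v → 3 ≤ 2 * w v + val v

  numEdges : ℕ
  numEdges = h / 2

  -- genus = b₁ + Σ w = (#E - #V + 1) + Σ w   (for connected graphs)
  genus : ℕ
  genus = (numEdges + 1 + sum (map w (allFin n))) ∸ n

  -- reachability in the graph with the half-edges satisfying D deleted
  -- (D is always used as a union of whole edges)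
  data Reach (D : Fin h → Set) : Fin n → Fin n → Set where
    here : ∀ {v} → Reach D v v
    step : ∀ {v} x → ¬ D x → Reach D (r (ι x)) v → Reach D (r x) v

  Connected : Set
  Connected = ∀ u v → Reach (λ _ → ⊥) u v

  Separating : Fin h → Set
  Separating e = Σ (Fin n) λ u → Σ (Fin n) λ v → ¬ Reach (λ x → SameEdge x e) u v

  NonSeparating : Fin h → Set
  NonSeparating e = ¬ Separating e

  C1Rel : Fin h → Fin h → Set
  C1Rel e f = SameEdge e f ⊎
    Σ (Fin n) λ u → Σ (Fin n) λ v → ¬ Reach (λ x → SameEdge x e ⊎ SameEdge x f) u v

  record Involution : Set where
    field
      σ       : Fin h → Fin h
      σV      : Fin n → Fin n
      σ-invol  : ∀ x → σ (σ x) ≡ x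
      σV-invol : ∀ v → σV (σV v) ≡ v
      σ-ι     : ∀ x → σ (ι x) ≡ ι (σ x)
      σ-r     : ∀ x → r (σ x) ≡ σV (r x)
      σ-w     : ∀ v → w (σV v) ≡ w v

  module _ (τ : Involution) where
    open Involution τ

    Flipped : Fin h → Set
    Flipped x = σ x ≡ ι x

    -- reachability in the quotient graph Γ/τ with the half-edges satisfying D deleted:
    -- vertices of Γ/τ are τ-orbits of vertices (so moving v ↦ σV v is free),
    -- edges are τ-orbits of non-flipped edges.
    data QReach (D : Fin h → Set) : Fin n → Fin n → Set where
      here  : ∀ {v} → QReach D v v
      jump  : ∀ {u v} → QReach D (σV u) v → QReach D u v
      step  : ∀ {v} x → ¬ Flipped x → ¬ D x → QReach D (r (ι x)) v → QReach D (r x) v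

    -- Γ/τ is a tree: it is connected and every edge of Γ/τ is a bridge
    -- (deleting the orbit of e disconnects Γ/τ); loops are thereby excluded.
    QuotientIsTree : Set
    QuotientIsTree =
      (∀ u v → QReach (λ _ → ⊥) u v) ×
      (∀ e → ¬ Flipped e →
         Σ (Fin n) λ u → Σ (Fin n) λ v →
           ¬ QReach (λ x → SameEdge x e ⊎ SameEdge x (σ e)) u v)

    IsHyperellipticInvolution : Set
    IsHyperellipticInvolution =
      (∀ v → 0 < w v → σV v ≡ v) ×
      QuotientIsTree ×
      (∀ e → Separating e → σ e ≡ e)

module Submission where

-- The heart is: if nonseparating edges g, e with g ∉ {e, τe} jointly disconnected Γ, the
-- component A of an end of e would have a cut of at most two edges.  Such a set is
-- τ-invariant, so τe leaves A as well and must be g or e.  For τ-invariance, A ∖ τA is a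
-- σ-free set (disjoint from its τ-image) whose cut is no larger than that of A, and no
-- nonempty σ-free set has a cut of at most two edges.  This is proved by induction on its
-- size: without an inner edge, any of its vertices is moved by τ, so has weight 0 and, by
-- stability, valence ≥ 3; with an inner edge x, x is not flipped, its orbit is a bridge of
-- the tree Γ/τ, and the Γ/τ-component of one end of x cuts the set into two smaller parts
-- whose cuts add up to at most four edges, so one part is again a counterexample.
--
-- Vertex sets are Boolean functions and cuts are counted in half-edges (two per edge).
-- Components are formed as decidable sets under double negation, which is harmless since
-- each is used to derive ⊥.

open import Defs
open import Data.Nat using (_≤_)
open import Data.Fin using (Fin)
open import Data.Product using (Σ; _×_)
open import Data.Sum using (_⊎_)
open import Relation.Nullary using (¬_)
open import Relation.Binary.PropositionalEquality using (_≡_)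

open import Data.Nat using (ℕ; zero; suc; _+_; _<_; _≤ᵇ_; z≤n; s≤s; _≤?_)
open import Data.Nat.Properties
open import Data.Fin using (zero; suc) renaming (_≟_ to _≟ᶠ_)
open import Data.Bool using (Bool; true; false; _∧_; not; _xor_; T)
open import Data.Bool.Properties using (¬-not; ∧-conicalˡ; ∧-zeroʳ)
open import Data.List using (length; filter; tabulate)
open import Data.Product using (_,_; proj₁; proj₂)
open import Data.Sum using (inj₁; inj₂; [_,_]′; swap)
open import Data.Empty using (⊥; ⊥-elim)
open import Data.Unit using (tt)
open import Relation.Nullary using (Dec; yes; no; does; _⊎-dec_; ¬¬-excluded-middle)
open import Relation.Nullary.Decidable using (dec-true; dec-false)
open import Relation.Unary using (Decidable)
open import Relation.Binary.PropositionalEquality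
  using (refl; sym; trans; cong; cong₂; subst; subst₂)
open import Function using (_∘_; id)
open import Data.Fin.Permutation using (permutation)
open import Algebra.Properties.CommutativeMonoid.Sum +-0-commutativeMonoid
  using (sum; sum-cong-≗; sum-permute; ∑-distrib-+; sum-replicate-zero)

𝟙 : Bool → ℕ
𝟙 true  = 1
𝟙 false = 0

𝟙≤1 : ∀ b → 𝟙 b ≤ 1
𝟙≤1 true  = s≤s z≤n
𝟙≤1 false = z≤n

𝟙-true : ∀ {b} → b ≡ true → 1 ≤ 𝟙 b
𝟙-true refl = ≤-refl

hit : ∀ {k} → Fin k → Fin k → ℕ
hit c y = 𝟙 (does (y ≟ᶠ c))

hit-self : ∀ {k} (c : Fin k) → 1 ≤ hit c c
hit-self c = 𝟙-true (dec-true (c ≟ᶠ c) refl)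

sum-hit : ∀ {k} (c : Fin k) → sum (hit c) ≡ 1
sum-hit {suc k} zero    = cong suc (sum-replicate-zero k)
sum-hit {suc k} (suc c) = sum-hit c

sum-mono-≤ : ∀ {k} {f g : Fin k → ℕ} → (∀ i → f i ≤ g i) → sum f ≤ sum g
sum-mono-≤ {zero}  le = z≤n
sum-mono-≤ {suc k} le = +-mono-≤ (le zero) (sum-mono-≤ (le ∘ suc))

term≤sum : ∀ {k} (f : Fin k → ℕ) i → f i ≤ sum f
term≤sum f zero    = m≤m+n (f zero) _
term≤sum f (suc i) = ≤-trans (term≤sum (f ∘ suc) i) (m≤n+m _ (f zero))

sum-involution : ∀ {k} (π : Fin k → Fin k) → (∀ x → π (π x) ≡ x) →
  (f : Fin k → ℕ) → sum (f ∘ π) ≡ sum f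
sum-involution π π-invol f = sym (sum-permute f (permutation π π π-invol π-invol))

length-filter-tabulate : ∀ {A : Set} {k} (f : Fin k → A) {P : A → Set} (P? : Decidable P) →
  length (filter P? (tabulate f)) ≡ sum (λ i → 𝟙 (does (P? (f i))))
length-filter-tabulate {k = zero}  f P? = refl
length-filter-tabulate {k = suc k} f P? with does (P? (f zero))
... | true  = cong suc (length-filter-tabulate (f ∘ suc) P?)
... | false = length-filter-tabulate (f ∘ suc) P?

half-≤ : ∀ {m n} → m + m ≤ n + n → m ≤ n
half-≤ {m} {n} le with m ≤? n
... | yes m≤n = m≤n
... | no  m≰n = ⊥-elim (<⇒≱ (+-mono-< (≰⇒> m≰n) (≰⇒> m≰n)) le)

one-of-≤ : ∀ a b n → a + b ≤ n + n → a ≤ n ⊎ b ≤ n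
one-of-≤ a b n le with a ≤? n | b ≤? n
... | yes a≤n | _       = inj₁ a≤n
... | no  _   | yes b≤n = inj₂ b≤n
... | no  a≰n | no  b≰n = ⊥-elim (<⇒≱ (+-mono-< (≰⇒> a≰n) (≰⇒> b≰n)) le)

≤-pred-+ : ∀ a b k → a + b ≤ suc k → 1 ≤ b → a ≤ k
≤-pred-+ a b k le 1≤b = ≤-pred (≤-trans (≤-reflexive (+-comm 1 a)) (≤-trans (+-monoʳ-≤ a 1≤b) le))

by-evaluation : ∀ {m n} → T (m ≤ᵇ n) → m ≤ n
by-evaluation = ≤ᵇ⇒≤ _ _

true≢false : ¬ (true ≡ false)
true≢false ()

dec-witness : ∀ {P : Set} (d : Dec P) → does d ≡ true → P
dec-witness (yes p) _ = p

-- A family of propositions on a finite set is decidable, up to double negation;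
-- this lets a proof of ⊥ form connected components as Boolean vertex sets.
¬¬-decidable : ∀ {k} (P : Fin k → Set) → ¬ ¬ (∀ i → Dec (P i))
¬¬-decidable {zero}  P kont = kont (λ ())
¬¬-decidable {suc k} P kont = ¬¬-excluded-middle λ d0 →
  ¬¬-decidable (P ∘ suc) λ ds → kont λ { zero → d0 ; (suc i) → ds i }

-- Crossings of A ∖ B and B ∖ A are crossings of A or of B (per half-edge, a, b are
-- membership of one end in A, B and c, d of the other end).
crossings-difference : ∀ a b c d →
  𝟙 ((a ∧ not b) xor (c ∧ not d)) + 𝟙 ((b ∧ not a) xor (d ∧ not c)) ≤ 𝟙 (a xor c) + 𝟙 (b xor d)
crossings-difference true  true  true  true  = by-evaluation tt
crossings-difference true  true  true  false = by-evaluation tt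
crossings-difference true  true  false true  = by-evaluation tt
crossings-difference true  true  false false = by-evaluation tt
crossings-difference true  false true  true  = by-evaluation tt
crossings-difference true  false true  false = by-evaluation tt
crossings-difference true  false false true  = by-evaluation tt
crossings-difference true  false false false = by-evaluation tt
crossings-difference false true  true  true  = by-evaluation tt
crossings-difference false true  true  false = by-evaluation tt
crossings-difference false true  false true  = by-evaluation tt
crossings-difference false true  false false = by-evaluation tt
crossings-difference false false true  true  = by-evaluation tt
crossings-difference false false true  false = by-evaluation tt
crossings-difference false false false true  = by-evaluation tt
crossings-difference false false false false = by-evaluation tt

-- Splitting U by S: crossings of U ∩ S and U ∖ S are crossings of U, plus (twice) the
-- edges inside U whose ends S separates (a, c: ends in U; s, t: ends in S).
crossings-split : ∀ a c s t →
  𝟙 ((a ∧ s) xor (c ∧ t)) + 𝟙 ((a ∧ not s) xor (c ∧ not t)) ≤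
  𝟙 (a xor c) + (𝟙 (a ∧ (c ∧ (s xor t))) + 𝟙 (a ∧ (c ∧ (s xor t))))
crossings-split true  true  true  true  = by-evaluation tt
crossings-split true  true  true  false = by-evaluation tt
crossings-split true  true  false true  = by-evaluation tt
crossings-split true  true  false false = by-evaluation tt
crossings-split true  false true  true  = by-evaluation tt
crossings-split true  false true  false = by-evaluation tt
crossings-split true  false false true  = by-evaluation tt
crossings-split true  false false false = by-evaluation tt
crossings-split false true  true  true  = by-evaluation tt
crossings-split false true  true  false = by-evaluation tt
crossings-split false true  false true  = by-evaluation tt
crossings-split false true  false false = by-evaluation tt
crossings-split false false _     _     = z≤n

𝟙-split : ∀ u s → 𝟙 (u ∧ s) + 𝟙 (u ∧ not s) ≡ 𝟙 u
𝟙-split true  true  = refl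
𝟙-split true  false = refl
𝟙-split false _     = refl

_∩_ _∖_ : ∀ {k} → (Fin k → Bool) → (Fin k → Bool) → Fin k → Bool
(U ∩ S) v = U v ∧ S v
(U ∖ S) v = U v ∧ not (S v)

size : ∀ {k} → (Fin k → Bool) → ℕ
size U = sum (𝟙 ∘ U)

size-split : ∀ {k} (U S : Fin k → Bool) → size (U ∩ S) + size (U ∖ S) ≡ size U
size-split U S = trans (sym (∑-distrib-+ (𝟙 ∘ (U ∩ S)) (𝟙 ∘ (U ∖ S))))
                       (sum-cong-≗ (λ v → 𝟙-split (U v) (S v)))

size-nonempty : ∀ {k} (U : Fin k → Bool) v → U v ≡ true → 1 ≤ size U
size-nonempty U v Uv = ≤-trans (𝟙-true Uv) (term≤sum (𝟙 ∘ U) v)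

module GraphFacts (G : WGraph) where
  open WGraph G

  _∼_ : Fin h → Fin h → Set
  _∼_ = SameEdge G

  _∼?_ : ∀ x y → Dec (x ∼ y)
  x ∼? y = (x ≟ᶠ y) ⊎-dec (x ≟ᶠ ι y)

  ι-injective : ∀ {a b} → ι a ≡ ι b → a ≡ b
  ι-injective {a} {b} eq = trans (sym (ι-invol a)) (trans (cong ι eq) (ι-invol b))

  ∼-ι : ∀ {z y} → ι z ∼ y → z ∼ y
  ∼-ι {z} (inj₁ p) = inj₂ (trans (sym (ι-invol z)) (cong ι p))
  ∼-ι     (inj₂ p) = inj₁ (ι-injective p)

  ∼-ιʳ : ∀ {y a} → y ∼ ι a → y ∼ a
  ∼-ιʳ     (inj₁ p) = inj₂ p
  ∼-ιʳ {a = a} (inj₂ p) = inj₁ (trans p (ι-invol a))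

  ∼-sym : ∀ {a b} → a ∼ b → b ∼ a
  ∼-sym     (inj₁ p) = inj₁ (sym p)
  ∼-sym {b = b} (inj₂ p) = inj₂ (trans (sym (ι-invol b)) (cong ι (sym p)))

  OnEdges : Fin h → Fin h → Fin h → Set
  OnEdges a b z = z ∼ a ⊎ z ∼ b

  OnEdges? : ∀ a b z → Dec (OnEdges a b z)
  OnEdges? a b z = (z ∼? a) ⊎-dec (z ∼? b)

  WholeEdges : (Fin h → Set) → Set
  WholeEdges D = ∀ x → ¬ D x → ¬ D (ι x)

  OnEdges-whole : ∀ a b → WholeEdges (OnEdges a b)
  OnEdges-whole a b z kept (inj₁ s) = kept (inj₁ (∼-ι s))
  OnEdges-whole a b z kept (inj₂ s) = kept (inj₂ (∼-ι s))

  reach-trans : ∀ {D u v w} → Reach G D u v → Reach G D v w → Reach G D u w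
  reach-trans here           q = q
  reach-trans (step x nd p) q = step x nd (reach-trans p q)

  reach-sym : ∀ {D} → WholeEdges D → ∀ {u v} → Reach G D u v → Reach G D v u
  reach-sym whole here = here
  reach-sym {D} whole (step x nd p) = reach-trans (reach-sym whole p)
    (subst (λ z → Reach G D (r (ι x)) (r z)) (ι-invol x) (step (ι x) (whole x nd) here))

  reach-bypass : ∀ {D D' : Fin h → Set} → (∀ x → Dec (D x)) →
    (∀ x → ¬ D' x → D x → Reach G D (r x) (r (ι x))) →
    ∀ {u v} → Reach G D' u v → Reach G D u v
  reach-bypass D? bypass here = here
  reach-bypass D? bypass (step x nd p) with D? x
  ... | yes dx = reach-trans (bypass x nd dx) (reach-bypass D? bypass p)
  ... | no ndx = step x ndx (reach-bypass D? bypass p)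

  -- crosses U y: the half-edge y joins U to its complement.  cutSize U counts
  -- crossing half-edges, i.e. twice the number of edges in the cut of U.
  crosses : (Fin n → Bool) → Fin h → ℕ
  crosses U y = 𝟙 (U (r y) xor U (r (ι y)))

  cutSize : (Fin n → Bool) → ℕ
  cutSize U = sum (crosses U)

  onEdge : Fin h → Fin h → ℕ
  onEdge a y = hit a y + hit (ι a) y

  sum-onEdge : ∀ a → sum (onEdge a) ≡ 2
  sum-onEdge a = trans (∑-distrib-+ (hit a) (hit (ι a))) (cong₂ _+_ (sum-hit a) (sum-hit (ι a)))

  onEdge-∼ : ∀ {y a} → y ∼ a → 1 ≤ onEdge a y
  onEdge-∼ {a = a} (inj₁ refl) = ≤-trans (hit-self a) (m≤m+n _ _)
  onEdge-∼ {a = a} (inj₂ refl) = ≤-trans (hit-self (ι a)) (m≤n+m _ _)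

  ClosedOff : (Fin h → Set) → (Fin n → Bool) → Set
  ClosedOff D U = ∀ y → ¬ D y → U (r y) ≡ true → U (r (ι y)) ≡ true

  closedOff-no-crossing : ∀ {D U} → WholeEdges D → ClosedOff D U →
    ∀ y → ¬ D y → crosses U y ≡ 0
  closedOff-no-crossing {U = U} whole closed y nd with U (r y) in e1 | U (r (ι y)) in e2
  ... | true  | true  = refl
  ... | false | false = refl
  ... | true  | false = ⊥-elim (true≢false (trans (sym (closed y nd e1)) e2))
  ... | false | true  = ⊥-elim (true≢false (trans (sym (subst (λ z → U (r z) ≡ true) (ι-invol y)
                          (closed (ι y) (whole y nd) e2))) e1))

  component-closedOff : ∀ {D a} (dec : ∀ v → Dec (Reach G D a v)) → ClosedOff D (λ v → does (dec v))
  component-closedOff dec y nd inside =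
    dec-true (dec _) (reach-trans (dec-witness (dec _) inside) (step y nd here))

  InnerEdge : (Fin n → Bool) → Set
  InnerEdge U = Σ (Fin h) λ y → U (r y) ≡ true × U (r (ι y)) ≡ true

  NoInnerEdge : (Fin n → Bool) → Set
  NoInnerEdge U = ∀ y → U (r y) ≡ true → U (r (ι y)) ≡ false

  valence-sum : ∀ v → val G v ≡ sum (λ y → hit v (r y))
  valence-sum v = length-filter-tabulate id (λ x → r x ≟ᶠ v)

  isolated-vertex-cut : ∀ U v → U v ≡ true → NoInnerEdge U → val G v + val G v ≤ cutSize U
  isolated-vertex-cut U v Uv noInner = begin
      val G v + val G v
        ≡⟨ cong₂ _+_ (valence-sum v)
                     (trans (valence-sum v) (sym (sum-involution ι ι-invol (λ y → hit v (r y))))) ⟩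
      sum (λ y → hit v (r y)) + sum (λ y → hit v (r (ι y)))
        ≡⟨ sym (∑-distrib-+ (λ y → hit v (r y)) (λ y → hit v (r (ι y)))) ⟩
      sum (λ y → hit v (r y) + hit v (r (ι y)))
        ≤⟨ sum-mono-≤ incident-crosses ⟩
      cutSize U ∎
    where
    open ≤-Reasoning
    inU : ∀ {u} → u ≡ v → U u ≡ true
    inU refl = Uv
    noInner⁻¹ : ∀ y → U (r (ι y)) ≡ true → U (r y) ≡ false
    noInner⁻¹ y inside = subst (λ z → U (r z) ≡ false) (ι-invol y) (noInner (ι y) inside)
    incident-crosses : ∀ y → hit v (r y) + hit v (r (ι y)) ≤ crosses U y
    incident-crosses y with r y ≟ᶠ v | r (ι y) ≟ᶠ v
    ... | yes p | yes q = ⊥-elim (true≢false (trans (sym (inU q)) (noInner y (inU p))))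
    ... | yes p | no _  rewrite inU p | noInner y (inU p) = ≤-refl
    ... | no _  | yes q rewrite inU q | noInner⁻¹ y (inU q) = ≤-refl
    ... | no _  | no _  = z≤n

  closedOff-cut : ∀ {D U} → (∀ y → Dec (D y)) → WholeEdges D → ClosedOff D U →
    (E : Fin h → ℕ) → (∀ y → D y → 1 ≤ E y) → cutSize U ≤ sum E
  closedOff-cut {U = U} D? whole closed E D⇒E = sum-mono-≤ crosses≤E
    where
    crosses≤E : ∀ y → crosses U y ≤ E y
    crosses≤E y with D? y
    ... | yes d  = ≤-trans (𝟙≤1 _) (D⇒E y d)
    ... | no  nd = ≤-trans (≤-reflexive (closedOff-no-crossing {U = U} whole closed y nd)) z≤n

  innerCrossing : (U S : Fin n → Bool) → Fin h → ℕ
  innerCrossing U S y = 𝟙 (U (r y) ∧ (U (r (ι y)) ∧ (S (r y) xor S (r (ι y)))))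

  split-cut : ∀ U S (E : Fin h → ℕ) → (∀ y → innerCrossing U S y ≤ E y) →
    cutSize (U ∩ S) + cutSize (U ∖ S) ≤ cutSize U + (sum E + sum E)
  split-cut U S E inner≤E = begin
      cutSize (U ∩ S) + cutSize (U ∖ S)
        ≡⟨ sym (∑-distrib-+ (crosses (U ∩ S)) (crosses (U ∖ S))) ⟩
      sum (λ y → crosses (U ∩ S) y + crosses (U ∖ S) y)
        ≤⟨ sum-mono-≤ pointwise ⟩
      sum (λ y → crosses U y + (E y + E y))
        ≡⟨ trans (∑-distrib-+ (crosses U) (λ y → E y + E y)) (cong (cutSize U +_) (∑-distrib-+ E E)) ⟩
      cutSize U + (sum E + sum E) ∎
    where
    open ≤-Reasoning
    pointwise : ∀ y → crosses (U ∩ S) y + crosses (U ∖ S) y ≤ crosses U y + (E y + E y)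
    pointwise y = ≤-trans (crossings-split (U (r y)) (U (r (ι y))) (S (r y)) (S (r (ι y))))
                          (+-monoʳ-≤ (crosses U y) (+-mono-≤ (inner≤E y) (inner≤E y)))

  second-edge-separates : ∀ g e → NonSeparating G g →
    (Σ (Fin n) λ u → Σ (Fin n) λ v → ¬ Reach G (OnEdges g e) u v) →
    ¬ Reach G (OnEdges g e) (r e) (r (ι e))
  second-edge-separates g e nsg (u , v , cut) path =
    nsg (u , v , λ p → cut (reach-bypass (OnEdges? g e) bypass p))
    where
    bypass : ∀ x → ¬ x ∼ g → OnEdges g e x → Reach G (OnEdges g e) (r x) (r (ι x))
    bypass x  x≁g (inj₁ x∼g)          = ⊥-elim (x≁g x∼g)
    bypass .e _   (inj₂ (inj₁ refl)) = path
    bypass .(ι e) _ (inj₂ (inj₂ refl)) =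
      subst (Reach G (OnEdges g e) (r (ι e)) ∘ r) (sym (ι-invol e)) (reach-sym (OnEdges-whole g e) path)

module InvolutionFacts (G : WGraph) (τ : Involution G) where
  open WGraph G
  open Involution τ
  open GraphFacts G

  σ-injective : ∀ {a b} → σ a ≡ σ b → a ≡ b
  σ-injective {a} {b} eq = trans (sym (σ-invol a)) (trans (cong σ eq) (σ-invol b))

  ∼-σ : ∀ {x e} → σ x ∼ σ e → x ∼ e
  ∼-σ     (inj₁ p) = inj₁ (σ-injective p)
  ∼-σ {e = e} (inj₂ p) = inj₂ (σ-injective (trans p (sym (σ-ι e))))

  r-ισ : ∀ x → r (ι (σ x)) ≡ σV (r (ι x))
  r-ισ x = trans (cong r (sym (σ-ι x))) (σ-r (ι x))

  flipped-ends : ∀ {x} → Flipped G τ x → r (ι x) ≡ σV (r x)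
  flipped-ends {x} fl = trans (cong r (sym fl)) (σ-r x)

  reach-σ : ∀ {D D' : Fin h → Set} → (∀ x → ¬ D x → ¬ D' (σ x)) →
    ∀ {u v} → Reach G D u v → Reach G D' (σV u) (σV v)
  reach-σ keep here = here
  reach-σ {D' = D'} keep {v = v} (step x nd p) =
    subst (λ z → Reach G D' z (σV v)) (σ-r x)
      (step (σ x) (keep x nd) (subst (λ z → Reach G D' z (σV v)) (sym (r-ισ x)) (reach-σ keep p)))

  nonseparating-σ : ∀ e → NonSeparating G e → NonSeparating G (σ e)
  nonseparating-σ e nse (u , v , cut) =
    nse (σV u , σV v , λ p → cut (subst₂ (Reach G _) (σV-invol u) (σV-invol v)
                                       (reach-σ (λ x kept s → kept (∼-σ s)) p)))

  qreach-trans : ∀ {D u v w} → QReach G τ D u v → QReach G τ D v w → QReach G τ D u w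
  qreach-trans here             q = q
  qreach-trans (jump p)         q = jump (qreach-trans p q)
  qreach-trans (step x nf nd p) q = step x nf nd (qreach-trans p q)

  qreach-σ⁻¹ : ∀ {D} u → QReach G τ D (σV u) u
  qreach-σ⁻¹ {D} u = jump (subst (λ z → QReach G τ D z u) (sym (σV-invol u)) here)

  ¬flipped-ι : ∀ x → ¬ Flipped G τ x → ¬ Flipped G τ (ι x)
  ¬flipped-ι x nf fl = nf (trans (sym (ι-invol (σ x))) (trans (cong ι (trans (sym (σ-ι x)) fl)) (ι-invol (ι x))))

  qreach-sym : ∀ {D} → WholeEdges D → ∀ {u v} → QReach G τ D u v → QReach G τ D v u
  qreach-sym whole here = here
  qreach-sym whole (jump {u} p) = qreach-trans (qreach-sym whole p) (qreach-σ⁻¹ u)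
  qreach-sym {D} whole (step x nf nd p) = qreach-trans (qreach-sym whole p)
    (subst (λ z → QReach G τ D (r (ι x)) (r z)) (ι-invol x) (step (ι x) (¬flipped-ι x nf) (whole x nd) here))

  qreach-bypass : ∀ {D D' : Fin h → Set} → (∀ x → Dec (D x)) →
    (∀ x → ¬ Flipped G τ x → D x → QReach G τ D (r x) (r (ι x))) →
    ∀ {u v} → QReach G τ D' u v → QReach G τ D u v
  qreach-bypass D? bypass here = here
  qreach-bypass D? bypass (jump p) = jump (qreach-bypass D? bypass p)
  qreach-bypass D? bypass (step x nf nd p) with D? x
  ... | yes dx = qreach-trans (bypass x nf dx) (qreach-bypass D? bypass p)
  ... | no ndx = step x nf ndx (qreach-bypass D? bypass p)

  -- A path in Γ projects to a path in Γ/τ (flipped edges become loops, which are skipped).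
  reach⇒qreach : ∀ {D₁ D₂ : Fin h → Set} → (∀ x → D₂ x → D₁ x) →
    ∀ {u v} → Reach G D₁ u v → QReach G τ D₂ u v
  reach⇒qreach D₂⊆D₁ here = here
  reach⇒qreach {D₂ = D₂} D₂⊆D₁ {v = v} (step x nd p) with σ x ≟ᶠ ι x
  ... | yes fl = jump (subst (λ z → QReach G τ D₂ z v) (flipped-ends fl) (reach⇒qreach D₂⊆D₁ p))
  ... | no  nf = step x nf (λ d → nd (D₂⊆D₁ x d)) (reach⇒qreach D₂⊆D₁ p)

  cutSize-σ : ∀ U → cutSize (U ∘ σV) ≡ cutSize U
  cutSize-σ U = trans (sum-cong-≗ crosses-σ) (sum-involution σ σ-invol (crosses U))
    where
    crosses-σ : ∀ y → crosses (U ∘ σV) y ≡ crosses U (σ y)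
    crosses-σ y = cong₂ (λ a b → 𝟙 (U a xor U b)) (sym (σ-r y)) (sym (r-ισ y))

  SigmaFree : (Fin n → Bool) → Set
  SigmaFree U = ∀ v → U v ≡ true → U (σV v) ≡ false

  σ-free-⊆ : ∀ {U V} → SigmaFree U → (∀ v → V v ≡ true → U v ≡ true) → SigmaFree V
  σ-free-⊆ {U} {V} free V⊆U v Vv with V (σV v) in eq
  ... | false = refl
  ... | true  = ⊥-elim (true≢false (trans (sym (V⊆U (σV v) eq)) (free v (V⊆U v Vv))))

  σ-free-part : ∀ A → SigmaFree (A ∖ (A ∘ σV))
  σ-free-part A v Uv rewrite σV-invol v | ∧-conicalˡ (A v) _ Uv = ∧-zeroʳ (A (σV v))

  σ-free-part-cut : ∀ A → cutSize (A ∖ (A ∘ σV)) ≤ cutSize A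
  σ-free-part-cut A = half-≤ (begin
      cutSize U + cutSize U
        ≡⟨ cong (cutSize U +_) (sym (cutSize-σ U)) ⟩
      cutSize U + cutSize (U ∘ σV)
        ≡⟨ sym (∑-distrib-+ (crosses U) (crosses (U ∘ σV))) ⟩
      sum (λ y → crosses U y + crosses (U ∘ σV) y)
        ≤⟨ sum-mono-≤ pointwise ⟩
      sum (λ y → crosses A y + crosses (A ∘ σV) y)
        ≡⟨ trans (∑-distrib-+ (crosses A) (crosses (A ∘ σV))) (cong (cutSize A +_) (cutSize-σ A)) ⟩
      cutSize A + cutSize A ∎)
    where
    open ≤-Reasoning
    U : Fin n → Bool
    U = A ∖ (A ∘ σV)
    Uσ : ∀ a → U (σV a) ≡ A (σV a) ∧ not (A a)
    Uσ a = cong (λ b → A (σV a) ∧ not (A b)) (σV-invol a)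
    pointwise : ∀ y → crosses U y + crosses (U ∘ σV) y ≤ crosses A y + crosses (A ∘ σV) y
    pointwise y rewrite Uσ (r y) | Uσ (r (ι y)) =
      crossings-difference (A (r y)) (A (σV (r y))) (A (r (ι y))) (A (σV (r (ι y))))

  qcomponent-closedOff : ∀ {D a} (dec : ∀ v → Dec (QReach G τ D a v)) →
    ClosedOff (λ y → Flipped G τ y ⊎ D y) (λ v → does (dec v))
  qcomponent-closedOff dec y kept inside =
    dec-true (dec _) (qreach-trans (dec-witness (dec _) inside) (step y (kept ∘ inj₁) (kept ∘ inj₂) here))

module Hyperelliptic (G : WGraph) (τ : Involution G)
       (hyp : IsHyperellipticInvolution G τ) (stab : Stable G) where
  open WGraph G
  open Involution τ
  open GraphFacts G
  open InvolutionFacts G τ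

  positive-weight-fixed : ∀ v → 0 < w v → σV v ≡ v
  positive-weight-fixed = proj₁ hyp

  quotient-connected : ∀ u v → QReach G τ (λ _ → ⊥) u v
  quotient-connected = proj₁ (proj₁ (proj₂ hyp))

  quotient-bridge : ∀ e → ¬ Flipped G τ e →
    Σ (Fin n) λ u → Σ (Fin n) λ v → ¬ QReach G τ (OnEdges e (σ e)) u v
  quotient-bridge = proj₂ (proj₁ (proj₂ hyp))

  -- A nonseparating edge is not fixed by τ: the orbit of a fixed edge is a bridge of
  -- Γ/τ, and a path in Γ avoiding it would project to Γ/τ.
  nonseparating-not-fixed : ∀ e → NonSeparating G e → ¬ (σ e ≡ e)
  nonseparating-not-fixed e nse fixed with quotient-bridge e (λ fl → ι-fpf e (trans (sym fl) fixed))
  ... | u , v , cut = nse (u , v , λ p → cut (reach⇒qreach orbit⊆edge p))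
    where
    orbit⊆edge : ∀ x → OnEdges e (σ e) x → x ∼ e
    orbit⊆edge x (inj₁ s) = s
    orbit⊆edge x (inj₂ s) = subst (x ∼_) fixed s

  -- Deleting the orbit of a non-flipped edge x separates its ends in Γ/τ,
  -- because Γ/τ is connected and the orbit is a bridge of it.
  orbit-separates-ends : ∀ x → ¬ Flipped G τ x →
    ¬ QReach G τ (OnEdges x (σ x)) (r x) (r (ι x))
  orbit-separates-ends x nf path with quotient-bridge x nf
  ... | u , v , cut = cut (qreach-bypass (OnEdges? x (σ x)) bypass (quotient-connected u v))
    where
    D : Fin h → Set
    D = OnEdges x (σ x)
    back : QReach G τ D (r (ι x)) (r x)
    back = qreach-sym (OnEdges-whole x (σ x)) path
    bypass : ∀ z → ¬ Flipped G τ z → D z → QReach G τ D (r z) (r (ι z))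
    bypass .x           _ (inj₁ (inj₁ refl)) = path
    bypass .(ι x)       _ (inj₁ (inj₂ refl)) = subst (QReach G τ D (r (ι x)) ∘ r) (sym (ι-invol x)) back
    bypass .(σ x)       _ (inj₂ (inj₁ refl)) = subst₂ (QReach G τ D) (sym (σ-r x)) (sym (r-ισ x))
      (qreach-trans (qreach-σ⁻¹ (r x)) (qreach-trans path (jump here)))
    bypass .(ι (σ x))   _ (inj₂ (inj₂ refl)) = subst₂ (QReach G τ D) (sym (r-ισ x))
      (trans (sym (σ-r x)) (cong r (sym (ι-invol (σ x)))))
      (qreach-trans (qreach-σ⁻¹ (r (ι x))) (qreach-trans back (jump here)))

  -- A vertex of a σ-free set is moved by τ, so it has weight 0 and, by stability, valence ≥ 3.
  σ-free-valence : ∀ {U} → SigmaFree U → ∀ v → U v ≡ true → 3 ≤ val G v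
  σ-free-valence {U} free v Uv with w v in wv | stab v
  ... | zero  | stable = stable
  ... | suc _ | _      = ⊥-elim (true≢false (trans (sym Uv) (subst (λ z → U z ≡ false) moved (free v Uv))))
    where
    moved : σV v ≡ v
    moved = positive-weight-fixed v (subst (0 <_) (sym wv) (s≤s z≤n))

  -- An edge inside a σ-free set is not flipped: τ would exchange its ends.
  σ-free-inner-not-flipped : ∀ {U} → SigmaFree U → ∀ x → U (r x) ≡ true → U (r (ι x)) ≡ true →
    ¬ Flipped G τ x
  σ-free-inner-not-flipped {U} free x Urx Urιx fl =
    true≢false (trans (sym Urιx) (subst (λ z → U z ≡ false) (sym (flipped-ends fl)) (free (r x) Urx)))

  -- A nonempty σ-free vertex set with cut at most 4 (two edges); these do not exist.
  record SmallCut (k : ℕ) : Set where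
    field
      U        : Fin n → Bool
      bounded  : size U ≤ k
      free     : SigmaFree U
      point    : Fin n
      nonempty : U point ≡ true
      smallCut : cutSize U ≤ 4

  -- With no edge inside U, a vertex of U of valence ≥ 3 already contributes 6 to the cut.
  small-cut-has-inner-edge : ∀ {k} (c : SmallCut k) → ¬ NoInnerEdge (SmallCut.U c)
  small-cut-has-inner-edge c noInner = <⇒≱ (σ-free-valence free point nonempty) (half-≤ (begin
      val G point + val G point ≤⟨ isolated-vertex-cut U point nonempty noInner ⟩
      cutSize U                 ≤⟨ smallCut ⟩
      2 + 2                     ∎))
    where
    open SmallCut c
    open ≤-Reasoning

  -- Splitting a small cut at an inner edge x along S, the Γ/τ-component of r x after
  -- deleting the orbit of x.  Edge x is the only inner edge whose ends S separates, so the
  -- two parts U ∩ S and U ∖ S have cuts adding up to at most 4 + 4, and one part is a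
  -- strictly smaller small cut.
  module SplitAtInnerEdge {k} (c : SmallCut (suc k)) (x : Fin h)
           (Urx : SmallCut.U c (r x) ≡ true) (Urιx : SmallCut.U c (r (ι x)) ≡ true)
           (dS : ∀ v → Dec (QReach G τ (OnEdges x (σ x)) (r x) v)) where
    open SmallCut c

    S : Fin n → Bool
    S v = does (dS v)

    S-start : S (r x) ≡ true
    S-start = dec-true (dS _) here

    S-end : S (r (ι x)) ≡ false
    S-end = dec-false (dS _) (orbit-separates-ends x (σ-free-inner-not-flipped free x Urx Urιx))

    outside : ∀ {u} → U u ≡ true → U (σV u) ≡ true → ⊥
    outside {u} Uu Uσu = true≢false (trans (sym Uσu) (free u Uu))

    only-x-separated : ∀ y → U (r y) ≡ true → U (r (ι y)) ≡ true →
      S (r y) ≡ true → S (r (ι y)) ≡ false → y ≡ x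
    only-x-separated y Ury Urιy Sry Srιy with σ y ≟ᶠ ι y
    ... | yes fl = ⊥-elim (σ-free-inner-not-flipped free y Ury Urιy fl)
    ... | no nf with OnEdges? x (σ x) y
    ...   | no nd = ⊥-elim (true≢false (trans (sym (qcomponent-closedOff dS y [ nf , nd ]′ Sry)) Srιy))
    ...   | yes (inj₁ (inj₁ y≡x)) = y≡x
    ...   | yes (inj₁ (inj₂ refl)) = ⊥-elim (true≢false (trans (sym Sry) S-end))
    ...   | yes (inj₂ (inj₁ refl)) = ⊥-elim (outside Urx (subst (λ z → U z ≡ true) (σ-r x) Ury))
    ...   | yes (inj₂ (inj₂ refl)) = ⊥-elim (outside Urιx (subst (λ z → U z ≡ true) (r-ισ x) Ury))

    inner-crossing≤onEdge : ∀ y → innerCrossing U S y ≤ onEdge x y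
    inner-crossing≤onEdge y with U (r y) in e1 | U (r (ι y)) in e2 | S (r y) in e3 | S (r (ι y)) in e4
    ... | true  | true  | true  | false = onEdge-∼ (inj₁ (only-x-separated y e1 e2 e3 e4))
    ... | true  | true  | false | true  = onEdge-∼ (inj₂ (trans (sym (ι-invol y)) (cong ι ιy≡x)))
      where
      ιy≡x : ι y ≡ x
      ιy≡x = only-x-separated (ι y) e2 (trans (cong (U ∘ r) (ι-invol y)) e1)
                               e4 (trans (cong (S ∘ r) (ι-invol y)) e3)
    ... | true  | true  | true  | true  = z≤n
    ... | true  | true  | false | false = z≤n
    ... | true  | false | _     | _     = z≤n
    ... | false | _     | _     | _     = z≤n

    parts-cut : cutSize (U ∩ S) + cutSize (U ∖ S) ≤ 4 + 4
    parts-cut = ≤-trans (split-cut U S (onEdge x) inner-crossing≤onEdge)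
      (≤-trans (≤-reflexive (cong (λ m → cutSize U + (m + m)) (sum-onEdge x))) (+-monoˡ-≤ 4 smallCut))

    U∩S-start : (U ∩ S) (r x) ≡ true
    U∩S-start = cong₂ _∧_ Urx S-start

    U∖S-end : (U ∖ S) (r (ι x)) ≡ true
    U∖S-end = cong₂ (λ a b → a ∧ not b) Urιx S-end

    part-bounded : ∀ (V W : Fin n → Bool) → size V + size W ≤ suc k → ∀ w → W w ≡ true → size V ≤ k
    part-bounded V W le w Ww = ≤-pred-+ (size V) (size W) k le (size-nonempty W w Ww)

    parts-bounded : size (U ∩ S) + size (U ∖ S) ≤ suc k
    parts-bounded = ≤-trans (≤-reflexive (size-split U S)) bounded

    smaller-part : SmallCut k
    smaller-part with one-of-≤ (cutSize (U ∩ S)) (cutSize (U ∖ S)) 4 parts-cut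
    ... | inj₁ cut≤4 = record
      { U = U ∩ S ; point = r x ; nonempty = U∩S-start ; smallCut = cut≤4
      ; bounded = part-bounded (U ∩ S) (U ∖ S) parts-bounded (r (ι x)) U∖S-end
      ; free = σ-free-⊆ free (λ v → ∧-conicalˡ (U v) _) }
    ... | inj₂ cut≤4 = record
      { U = U ∖ S ; point = r (ι x) ; nonempty = U∖S-end ; smallCut = cut≤4
      ; bounded = part-bounded (U ∖ S) (U ∩ S)
                    (≤-trans (≤-reflexive (+-comm (size (U ∖ S)) (size (U ∩ S)))) parts-bounded)
                    (r x) U∩S-start
      ; free = σ-free-⊆ free (λ v → ∧-conicalˡ (U v) _) }

  no-small-cut : ∀ k → ¬ SmallCut k
  no-small-cut zero    c = <⇒≱ (size-nonempty U point nonempty) bounded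
    where open SmallCut c
  no-small-cut (suc k) c = ¬¬-excluded-middle by-cases
    where
    open SmallCut c
    by-cases : ¬ Dec (InnerEdge U)
    by-cases (yes (x , Urx , Urιx)) = ¬¬-decidable (QReach G τ (OnEdges x (σ x)) (r x)) λ dS →
      no-small-cut k (SplitAtInnerEdge.smaller-part c x Urx Urιx dS)
    by-cases (no none) = small-cut-has-inner-edge c λ y Ury → ¬-not λ Urιy → none (y , Ury , Urιy)

  -- A vertex set whose cut has at most two edges is τ-invariant: otherwise A ∖ τA
  -- would be a small cut.
  small-cut-σ-invariant : ∀ A → cutSize A ≤ 4 → ∀ v → A v ≡ true → A (σV v) ≡ true
  small-cut-σ-invariant A cut≤4 v Av with A (σV v) in Aσv
  ... | true  = refl
  ... | false = ⊥-elim (no-small-cut _ record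
    { U = A ∖ (A ∘ σV) ; bounded = ≤-refl ; free = σ-free-part A
    ; point = v ; nonempty = cong₂ (λ a b → a ∧ not b) Av Aσv
    ; smallCut = ≤-trans (σ-free-part-cut A) cut≤4 })

  -- Suppose deleting the edges g and e disconnects the graph while deleting g alone does
  -- not.  The component A of r e avoiding both edges has a cut of at most these two edges,
  -- so A is τ-invariant; A contains r e but not r (ι e), so τe leaves A and must be g or e.
  module TwoEdgeCut (g e : Fin h) (nsg : NonSeparating G g)
           (disconnects : Σ (Fin n) λ u → Σ (Fin n) λ v → ¬ Reach G (OnEdges g e) u v)
           (dA : ∀ v → Dec (Reach G (OnEdges g e) (r e) v)) where
    A : Fin n → Bool
    A v = does (dA v)

    ends-apart : A (r (ι e)) ≡ false
    ends-apart = dec-false (dA _) (second-edge-separates g e nsg disconnects)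

    cut≤4 : cutSize A ≤ 4
    cut≤4 = ≤-trans (closedOff-cut {U = A} (OnEdges? g e) (OnEdges-whole g e) (component-closedOff dA) E deleted⇒E)
                    (≤-reflexive (trans (∑-distrib-+ (onEdge g) (onEdge e))
                                        (cong₂ _+_ (sum-onEdge g) (sum-onEdge e))))
      where
      E : Fin h → ℕ
      E y = onEdge g y + onEdge e y
      deleted⇒E : ∀ y → OnEdges g e y → 1 ≤ E y
      deleted⇒E y (inj₁ y∼g) = ≤-trans (onEdge-∼ y∼g) (m≤m+n (onEdge g y) (onEdge e y))
      deleted⇒E y (inj₂ y∼e) = ≤-trans (onEdge-∼ y∼e) (m≤n+m (onEdge e y) (onEdge g y))

    A-σe : A (r (σ e)) ≡ true
    A-σe = subst (λ z → A z ≡ true) (sym (σ-r e)) (small-cut-σ-invariant A cut≤4 (r e) (dec-true (dA _) here))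

    A-ισe : A (r (ι (σ e))) ≡ false
    A-ισe rewrite r-ισ e with A (σV (r (ι e))) in Aσιe
    ... | false = refl
    ... | true  = trans (sym (subst (λ z → A z ≡ true) (σV-invol _) (small-cut-σ-invariant A cut≤4 _ Aσιe)))
                        ends-apart

    -- e is not flipped, since A contains r (τe) but not r (ι e).
    σe-not-flipped : ¬ Flipped G τ e
    σe-not-flipped flipped = true≢false (trans (sym (subst (λ z → A (r z) ≡ true) flipped A-σe)) ends-apart)

    -- τe leaves A, so it is one of the deleted edges.
    σe-deleted : OnEdges g e (σ e)
    σe-deleted with OnEdges? g e (σ e)
    ... | yes deleted = deleted
    ... | no  kept    = ⊥-elim (true≢false (trans (sym (component-closedOff dA (σ e) kept A-σe)) A-ισe))

  two-edge-cut : ∀ e g → NonSeparating G e → NonSeparating G g → ¬ g ∼ σ e →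
    ¬ (Σ (Fin n) λ u → Σ (Fin n) λ v → ¬ Reach G (OnEdges g e) u v)
  two-edge-cut e g nse nsg g≁σe disconnects = ¬¬-decidable (Reach G (OnEdges g e) (r e)) λ dA →
    let open TwoEdgeCut g e nsg disconnects dA in
    [ g≁σe ∘ ∼-sym , [ nonseparating-not-fixed e nse , σe-not-flipped ]′ ]′ σe-deleted

  C1-class⊆orbit : ∀ e → NonSeparating G e →
    ∀ g → NonSeparating G g → C1Rel G g e → g ∼ e ⊎ g ∼ σ e
  C1-class⊆orbit e nse g nsg (inj₁ same) = inj₁ same
  C1-class⊆orbit e nse g nsg (inj₂ disconnects) with g ∼? σ e
  ... | yes g∼σe = inj₂ g∼σe
  ... | no  g≁σe = ⊥-elim (two-edge-cut e g nse nsg g≁σe disconnects)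

  -- If τ does not flip e, then e and τe are C1-related: their orbit is a bridge of Γ/τ.
  orbit-C1 : ∀ e → ¬ Flipped G τ e → C1Rel G (σ e) e
  orbit-C1 e nf with quotient-bridge e nf
  ... | u , v , cut = inj₂ (u , v , λ p → cut (reach⇒qreach (λ _ → swap) p))

proposition2p3 : (L : Set) (Γ : TropCurve L) →
    let G = TropCurve.graph Γ in
    Connected G → Stable G → 2 ≤ genus G →
    (τ : Involution G) →
    (∀ x → TropCurve.len Γ (Involution.σ τ x) ≡ TropCurve.len Γ x) →
    IsHyperellipticInvolution G τ →
    (e : Fin (WGraph.h G)) → NonSeparating G e →
    ((∀ f → NonSeparating G f → C1Rel G f e → SameEdge G f e)
    × Flipped G τ e)
    ⊎ (Σ (Fin (WGraph.h G)) λ f →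
    NonSeparating G f × C1Rel G f e × ¬ SameEdge G f e
    × SameEdge G (Involution.σ τ e) f
    × (∀ g → NonSeparating G g → C1Rel G g e → SameEdge G g e ⊎ SameEdge G g f))
proposition2p3 _ Γ _ stab _ τ _ hyp e nse
  with Involution.σ τ e ≟ᶠ WGraph.ι (TropCurve.graph Γ) e
... | yes flipped = inj₁ (only-e , flipped)
  where
  open GraphFacts (TropCurve.graph Γ)
  open Hyperelliptic (TropCurve.graph Γ) τ hyp stab
  -- τe is e reversed, so the C1-class of e is {e}.
  only-e : ∀ f → NonSeparating _ f → C1Rel _ f e → f ∼ e
  only-e f nsf c1 = [ id , (λ f∼σe → ∼-ιʳ (subst (f ∼_) flipped f∼σe)) ]′ (C1-class⊆orbit e nse f nsf c1)
... | no not-flipped = inj₂ (σ e , nonseparating-σ e nse , orbit-C1 e not-flipped , distinct , inj₁ refl ,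
                             C1-class⊆orbit e nse)
  where
  open Involution τ
  open GraphFacts (TropCurve.graph Γ)
  open InvolutionFacts (TropCurve.graph Γ) τ
  open Hyperelliptic (TropCurve.graph Γ) τ hyp stab
  -- τe is a different edge: it is neither fixed (e is nonseparating) nor flipped.
  distinct : ¬ σ e ∼ e
  distinct (inj₁ fixed)   = nonseparating-not-fixed e nse fixed
  distinct (inj₂ flipped) = not-flipped flipped
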